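{- Let $\varphi:\boldsymbol{\Pi}\to\mathbf{FL}$ have components $\varphi_G(m_\pi)=M_{F(\pi)}$ where $F(\pi)=\bigcup_{B\in\pi}E(G_B)$. Let $\pi:\mathbf{S\Pi}\to\mathbf{E}$ send every $m_\sigma$ ($\sigma$ stable) to $1$, let $\iota:\mathbf{S\Pi}\to\boldsymbol{\Pi}$ be the inclusion, and let $\iota:\mathbf{E}\to\mathbf{FL}$ send $1\in\mathbf{E}[G]$ to $M_\emptyset$. Then all four maps are morphisms of Hopf monoids and $\varphi\circ\iota=\iota\circ\pi$ as maps $\mathbf{S\Pi}\to\mathbf{FL}$.
   Context: All graphs are finite simple graphs over a field $\mathbb{K}$; $G_S$ is the induced subgraph with edge set $E(G_S)$. Hopf monoids are in graphical species (functors from finite graphs with isomorphisms to $\mathbb{K}$-vector spaces) with respect to the Cauchy product $(\mathbf{g}\cdot\mathbf{h})[G]=\bigoplus_{S|T\models V(G)}\mathbf{g}[G_S]\otimes\mathbf{h}[G_T]$ and symmetry $x\otimes y\mapsto y\otimes x$. $\boldsymbol{\Pi}[G]$ has basis $\{m_\pi:\pi\vdash V(G)\}$ with product $m_\sigma\otimes m_\tau\mapsto m_{\sigma\cup\tau}$ and coproduct $m_\pi\mapsto m_{\pi|_S}\otimes m_{\pi|_T}$. $\mathbf{S\Pi}$ is the Hopf submonoid spanned by $m_\pi$ with $\pi$ stable (no edge inside a block). For $D\subseteq E(G)$, $\pi_D$ is the partition into components of $(V(G),D)$; $D$ is a flat if $D=\bigcup_{B\in\pi_D}E(G_B)$. $\mathbf{FL}[G]$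 has basis $\{M_F\}$ indexed by flats, product $M_F\otimes M_H\mapsto M_{F\sqcup H}$, coproduct $M_F\mapsto M_{F|_S}\otimes M_{F|_T}$ with $F|_S=\{uv\in F:u,v\in S\}$. $\mathbf{E}[G]=\mathbb{K}$ with product and coproduct the canonical isomorphisms $\mathbb{K}\otimes\mathbb{K}\cong\mathbb{K}$. -}

module Defs where

open import Data.Nat using (ℕ)
open import Data.Fin using (Fin)
open import Data.Bool using (Bool; true; false; _∧_; _∨_)
open import Data.Product using (_×_; _,_)
open import Data.Unit using (⊤; tt)
open import Relation.Binary.PropositionalEquality using (_≡_)

record Graph (n : ℕ) : Set where
  field
    adj        : Fin n → Fin n → Bool
    adj-sym    : ∀ u v → adj u v ≡ adj v u
    adj-irrefl : ∀ u → adj u u ≡ false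
open Graph public

record Iso {n : ℕ} (G H : Graph n) : Set where
  field
    to      : Fin n → Fin n
    from    : Fin n → Fin n
    to-from : ∀ x → to (from x) ≡ x
    from-to : ∀ x → from (to x) ≡ x
    pres    : ∀ x y → adj H (to x) (to y) ≡ adj G x y
open Iso public

-- Subsets of the ambient vertex set; G_U is the induced subgraph on U

Sub : ℕ → Set
Sub n = Fin n → Bool

∅ₛ : ∀ {n} → Sub n
∅ₛ _ = false

record Decomp {n : ℕ} (U S T : Sub n) : Set where
  field
    cover : ∀ x → U x ≡ (S x ∨ T x)
    disj  : ∀ x → (S x ∧ T x) ≡ false

BRel : ℕ → Set
BRel n = Fin n → Fin n → Bool

_≐_ : ∀ {n} → BRel n → BRel n → Set
R ≐ R' = ∀ x y → R x y ≡ R' x y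

∅ᵣ : ∀ {n} → BRel n
∅ᵣ _ _ = false

_∪ᵣ_ : ∀ {n} → BRel n → BRel n → BRel n
(R ∪ᵣ R') x y = R x y ∨ R' x y

_∣ᵣ_ : ∀ {n} → BRel n → Sub n → BRel n
(R ∣ᵣ S) x y = R x y ∧ (S x ∧ S y)

relabelᵣ : ∀ {n} → (Fin n → Fin n) → BRel n → BRel n
relabelᵣ q R x y = R (q x) (q y)

-- Set partitions of U, encoded by their "same block" relation

record IsPartition {n : ℕ} (U : Sub n) (R : BRel n) : Set where
  field
    support : ∀ x y → R x y ≡ true → (U x ≡ true) × (U y ≡ true)
    refl-on : ∀ x → U x ≡ true → R x x ≡ true
    symm    : ∀ x y → R x y ≡ R y x
    trans   : ∀ x y z → R x y ≡ true → R y z ≡ true → R x z ≡ true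

Stable : ∀ {n} → Graph n → BRel n → Set
Stable G R = ∀ x y → R x y ≡ true → adj G x y ≡ false

data Path {n : ℕ} (D : BRel n) : Fin n → Fin n → Set where
  here : ∀ {x} → Path D x x
  step : ∀ {x y z} → D x y ≡ true → Path D y z → Path D x z

-- D is a flat of G_U:  D ⊆ E(G_U)  and  D = ⋃_{B ∈ π_D} E(G_B),
-- where the blocks of π_D are the components of (U, D) (Path-connectivity).
record IsFlat {n : ℕ} (G : Graph n) (U : Sub n) (D : BRel n) : Set where
  field
    edges  : ∀ x y → D x y ≡ true →
             (adj G x y ≡ true) × (U x ≡ true) × (U y ≡ true)
    symm   : ∀ x y → D x y ≡ D y x
    closed : ∀ x y → adj G x y ≡ true → U x ≡ true → U y ≡ true →
             Path D x y → D x y ≡ true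

Fπ : ∀ {n} → Graph n → BRel n → BRel n
Fπ G R x y = adj G x y ∧ R x y

-- Linearized set graphical species with Hopf structure given on bases.
-- h[G_U] has basis { x : Carrier n | Valid G U x } modulo _≈_;
-- product  μ : h[G_S] ⊗ h[G_T] → h[G_U],  b ⊗ b' ↦ μ b b'
-- coproduct Δ_{S,T} : b ↦ res S b ⊗ res T b
-- unit η ∈ h[∅];  action of an iso with inverse q: relabel q.

record HSpecies : Set₁ where
  field
    Carrier : ℕ → Set
    Valid   : ∀ {n} → Graph n → Sub n → Carrier n → Set
    _≈_     : ∀ {n} → Carrier n → Carrier n → Set
    μ       : ∀ {n} → Carrier n → Carrier n → Carrier n
    res     : ∀ {n} → Sub n → Carrier n → Carrier n
    η       : ∀ {n} → Carrier n
    relabel : ∀ {n} → (Fin n → Fin n) → Carrier n → Carrier n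
open HSpecies public

Πₛ : HSpecies
Πₛ = record
  { Carrier = BRel
  ; Valid   = λ G U R → IsPartition U R
  ; _≈_     = _≐_
  ; μ       = _∪ᵣ_
  ; res     = λ S R → R ∣ᵣ S
  ; η       = ∅ᵣ
  ; relabel = relabelᵣ
  }

SΠₛ : HSpecies
SΠₛ = record
  { Carrier = BRel
  ; Valid   = λ G U R → IsPartition U R × Stable G R
  ; _≈_     = _≐_
  ; μ       = _∪ᵣ_
  ; res     = λ S R → R ∣ᵣ S
  ; η       = ∅ᵣ
  ; relabel = relabelᵣ
  }

FLₛ : HSpecies
FLₛ = record
  { Carrier = BRel
  ; Valid   = λ G U D → IsFlat G U D
  ; _≈_     = _≐_
  ; μ       = _∪ᵣ_
  ; res     = λ S D → D ∣ᵣ S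
  ; η       = ∅ᵣ
  ; relabel = relabelᵣ
  }

Eₛ : HSpecies
Eₛ = record
  { Carrier = λ _ → ⊤
  ; Valid   = λ _ _ _ → ⊤
  ; _≈_     = λ _ _ → ⊤
  ; μ       = λ _ _ → tt
  ; res     = λ _ _ → tt
  ; η       = tt
  ; relabel = λ _ _ → tt
  }

Map : HSpecies → HSpecies → Set
Map h k = ∀ {n} → Graph n → Sub n → Carrier h n → Carrier k n

-- Morphism of Hopf monoids (on bases): well defined, natural w.r.t.
-- graph isomorphisms, compatible with products, coproducts and unit.
-- (Counit compatibility is automatic: both counits send every basis
-- element of h[∅] to 1.)
record IsHopfMorphism (h k : HSpecies) (f : Map h k) : Set where
  field
    valid    : ∀ {n} (G : Graph n) (U : Sub n) (b : Carrier h n) →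
               Valid h G U b → Valid k G U (f G U b)
    respects : ∀ {n} (G : Graph n) (U : Sub n) (b b' : Carrier h n) →
               Valid h G U b → Valid h G U b' → _≈_ h b b' →
               _≈_ k (f G U b) (f G U b')
    natural  : ∀ {n} (G H : Graph n) (i : Iso G H) (U : Sub n) (b : Carrier h n) →
               Valid h G U b →
               _≈_ k (f H (λ x → U (from i x)) (relabel h (from i) b))
                     (relabel k (from i) (f G U b))
    mult     : ∀ {n} (G : Graph n) (U S T : Sub n) → Decomp U S T →
               (b b' : Carrier h n) → Valid h G S b → Valid h G T b' →
               _≈_ k (f G U (μ h b b')) (μ k (f G S b) (f G T b'))
    comult   : ∀ {n} (G : Graph n) (U S T : Sub n) → Decomp U S T →
               (b : Carrier h n) → Valid h G U b →
               (_≈_ k (f G S (res h S b)) (res k S (f G U b))) ×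
               (_≈_ k (f G T (res h T b)) (res k T (f G U b)))
    unit     : ∀ {n} (G : Graph n) → _≈_ k (f G ∅ₛ (η h)) (η k)

φ : Map Πₛ FLₛ
φ G U R = Fπ G R

πE : Map SΠₛ Eₛ
πE _ _ _ = tt

ιΠ : Map SΠₛ Πₛ
ιΠ _ _ R = R

ιFL : Map Eₛ FLₛ
ιFL _ _ _ = ∅ᵣ

-- A partition π of U gives the flat F(π): a path in F(π) starting in U never
-- leaves the block of its start, so every edge whose ends are joined by such a
-- path already lies inside a block.  A stable partition has no edge inside a
-- block, so F(σ) = ∅ and φ ∘ ι = ι ∘ π.  The remaining axioms of the four maps
-- are pointwise Boolean identities.
module Submission where

open import Defs
open import Data.Bool using (Bool; true; false; _∧_)
open import Data.Bool.Properties using (∧-assoc; ∧-zeroʳ; ∧-distribˡ-∨)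
open import Data.Fin using (Fin)
open import Data.Product using (_×_; _,_; proj₁; proj₂)
open import Data.Unit using (tt)
open import Relation.Binary.PropositionalEquality

∧≡true⇒ : ∀ {a b : Bool} → (a ∧ b) ≡ true → (a ≡ true) × (b ≡ true)
∧≡true⇒ {true} {true} _ = refl , refl

adj-from : ∀ {n} {G H : Graph n} (i : Iso G H) (x y : Fin n) →
           adj H x y ≡ adj G (from i x) (from i y)
adj-from {G = G} {H} i x y = begin
  adj H x y                                 ≡⟨ sym (cong₂ (adj H) (to-from i x) (to-from i y)) ⟩
  adj H (to i (from i x)) (to i (from i y)) ≡⟨ pres i (from i x) (from i y) ⟩
  adj G (from i x) (from i y)               ∎
  where open ≡-Reasoning

Path-∅ᵣ⇒≡ : ∀ {n} {x y : Fin n} → Path ∅ᵣ x y → x ≡ y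
Path-∅ᵣ⇒≡ here = refl

Path-Fπ⇒sameBlock : ∀ {n} (G : Graph n) {U : Sub n} {R : BRel n} →
                    IsPartition U R → ∀ {x z} → U x ≡ true →
                    Path (Fπ G R) x z → R x z ≡ true
Path-Fπ⇒sameBlock G {U} {R} P ux here = IsPartition.refl-on P _ ux
Path-Fπ⇒sameBlock G {U} {R} P {x} ux (step {y = y} e p) =
  IsPartition.trans P x y _ Rxy (Path-Fπ⇒sameBlock G P uy p)
  where
    Rxy : R x y ≡ true
    Rxy = proj₂ (∧≡true⇒ {adj G x y} e)
    uy : U y ≡ true
    uy = proj₂ (IsPartition.support P x y Rxy)

Fπ-isFlat : ∀ {n} (G : Graph n) {U : Sub n} {R : BRel n} →
            IsPartition U R → IsFlat G U (Fπ G R)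
Fπ-isFlat G {U} {R} P = record
  { edges  = edges
  ; symm   = λ x y → cong₂ _∧_ (adj-sym G x y) (IsPartition.symm P x y)
  ; closed = λ x y xy ux _ p →
      cong₂ _∧_ xy (Path-Fπ⇒sameBlock G P ux p)
  }
  where
    edges : ∀ x y → Fπ G R x y ≡ true →
            (adj G x y ≡ true) × (U x ≡ true) × (U y ≡ true)
    edges x y e with ∧≡true⇒ {adj G x y} e
    ... | xy , Rxy = xy , IsPartition.support P x y Rxy

∅ᵣ-isFlat : ∀ {n} (G : Graph n) (U : Sub n) → IsFlat G U ∅ᵣ
∅ᵣ-isFlat G U = record
  { edges  = λ _ _ ()
  ; symm   = λ _ _ → refl
  ; closed = λ x y xy _ _ p → trans (sym (≡⇒nonadjacent (Path-∅ᵣ⇒≡ p))) xy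
  }
  where
    ≡⇒nonadjacent : ∀ {x y} → x ≡ y → adj G x y ≡ false
    ≡⇒nonadjacent {x} refl = adj-irrefl G x

Fπ-stable≐∅ᵣ : ∀ {n} (G : Graph n) {σ : BRel n} → Stable G σ → Fπ G σ ≐ ∅ᵣ
Fπ-stable≐∅ᵣ G {σ} st x y with σ x y in σxy
... | true  = cong (_∧ true) (st x y σxy)
... | false = ∧-zeroʳ (adj G x y)

φ-isHopfMorphism : IsHopfMorphism Πₛ FLₛ φ
φ-isHopfMorphism = record
  { valid    = λ G _ _ → Fπ-isFlat G
  ; respects = λ G _ _ _ _ _ R≐R' x y → cong (adj G x y ∧_) (R≐R' x y)
  ; natural  = λ _ _ i _ R _ x y → cong (_∧ R (from i x) (from i y)) (adj-from i x y)
  ; mult     = λ G _ _ _ _ R R' _ _ x y → ∧-distribˡ-∨ (adj G x y) (R x y) (R' x y)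
  ; comult   = λ G _ _ _ _ R _ →
      (λ x y → sym (∧-assoc (adj G x y) (R x y) _)) ,
      (λ x y → sym (∧-assoc (adj G x y) (R x y) _))
  ; unit     = λ G x y → ∧-zeroʳ (adj G x y)
  }

πE-isHopfMorphism : IsHopfMorphism SΠₛ Eₛ πE
πE-isHopfMorphism = record
  { valid    = λ _ _ _ _ → tt
  ; respects = λ _ _ _ _ _ _ _ → tt
  ; natural  = λ _ _ _ _ _ _ → tt
  ; mult     = λ _ _ _ _ _ _ _ _ _ → tt
  ; comult   = λ _ _ _ _ _ _ _ → tt , tt
  ; unit     = λ _ → tt
  }

ιΠ-isHopfMorphism : IsHopfMorphism SΠₛ Πₛ ιΠ
ιΠ-isHopfMorphism = record
  { valid    = λ _ _ _ → proj₁
  ; respects = λ _ _ _ _ _ _ σ≐σ' → σ≐σ'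
  ; natural  = λ _ _ _ _ _ _ _ _ → refl
  ; mult     = λ _ _ _ _ _ _ _ _ _ _ _ → refl
  ; comult   = λ _ _ _ _ _ _ _ → (λ _ _ → refl) , (λ _ _ → refl)
  ; unit     = λ _ _ _ → refl
  }

ιFL-isHopfMorphism : IsHopfMorphism Eₛ FLₛ ιFL
ιFL-isHopfMorphism = record
  { valid    = λ G U _ _ → ∅ᵣ-isFlat G U
  ; respects = λ _ _ _ _ _ _ _ _ _ → refl
  ; natural  = λ _ _ _ _ _ _ _ _ → refl
  ; mult     = λ _ _ _ _ _ _ _ _ _ _ _ → refl
  ; comult   = λ _ _ _ _ _ _ _ → (λ _ _ → refl) , (λ _ _ → refl)
  ; unit     = λ _ _ _ → refl
  }

mainTheorem13 : IsHopfMorphism Πₛ FLₛ φ × IsHopfMorphism SΠₛ Eₛ πE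
                × IsHopfMorphism SΠₛ Πₛ ιΠ × IsHopfMorphism Eₛ FLₛ ιFL
                × (∀ {n} (G : Graph n) (U : Sub n) (σ : Carrier SΠₛ n) →
                   Valid SΠₛ G U σ →
                   _≈_ FLₛ (φ G U (ιΠ G U σ)) (ιFL G U (πE G U σ)))
mainTheorem13 =
  φ-isHopfMorphism , πE-isHopfMorphism , ιΠ-isHopfMorphism , ιFL-isHopfMorphism ,
  λ G _ _ (_ , stable) → Fπ-stable≐∅ᵣ G stable
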